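{- Let $L$ be a cover of the cube $\{0,1\}^n$ and let $L'\subseteq L$ be an essentialisation of $L$. Let $M'$ be the set of variables appearing with nonzero coefficient in some polynomial of $L'$. Then $L'$ is an essential cover of $\{0,1\}^{M'}$.
   Context: A set $L$ of linear polynomials with real coefficients is a cover of $\{0,1\}^I$ (for an index set $I$ of variables) if for every $v\in\{0,1\}^I$ some $p\in L$ has $p(v)=0$. An essentialisation of a cover $L$ of $\{0,1\}^I$ is a subset $L'\subseteq L$ that covers $\{0,1\}^I$ but no proper subset of which does. $L$ is an essential cover of $\{0,1\}^I$ if (E1) $L$ covers $\{0,1\}^I$, (E2) no proper subset of $L$ covers $\{0,1\}^I$, and (E3) every variable in $I$ appears with nonzero coefficient in some polynomial of $L$. -}

module Defs where

open import Level using (Level; _⊔_)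
open import Algebra.Bundles using (CommutativeRing)
open import Data.Nat using (ℕ)
open import Data.Fin using (Fin; zero; suc)
open import Data.Bool using (Bool; true; false)
open import Data.Product using (Σ; ∃; _×_; _,_)
open import Data.Fin.Subset as Sub using (Subset)
open import Relation.Nullary using (¬_)
open import Relation.Unary using (Pred)
open import Relation.Binary.PropositionalEquality using (_≡_)

module Lin {c ℓ : Level} (R : CommutativeRing c ℓ) where
  open CommutativeRing R using (_≈_; _+_; _*_; 0#; 1#) renaming (Carrier to K)

  record LinPoly (n : ℕ) : Set c where
    constructor linPoly
    field
      coeff : Fin n → K
      const : K
  open LinPoly public

  sumFin : {n : ℕ} → (Fin n → K) → K
  sumFin {ℕ.zero}  f = 0#
  sumFin {ℕ.suc n} f = f zero + sumFin (λ i → f (suc i))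

  bit : Bool → K
  bit true  = 1#
  bit false = 0#

  eval : {n : ℕ} → LinPoly n → (Fin n → Bool) → K
  eval p v = const p + sumFin (λ i → coeff p i * bit (v i))

  -- A point of the cube {0,1}^M, for a set M of variables, is represented by
  -- a 0/1 assignment of all n variables which is 0 outside M.
  PointOf : {n : ℕ} {ℓ' : Level} → Pred (Fin n) ℓ' → (Fin n → Bool) → Set ℓ'
  PointOf M v = ∀ i → ¬ M i → v i ≡ false

  PolyIn : {n : ℕ} {ℓ' : Level} → Pred (Fin n) ℓ' → LinPoly n → Set (ℓ ⊔ ℓ')
  PolyIn M p = ∀ i → ¬ M i → coeff p i ≈ 0#

  -- a (finite) family L of polynomials, indexed by Fin m; sub-collections of L
  -- are subsets S of the index set Fin m.

  Covers : {n m : ℕ} {ℓ' : Level} → Pred (Fin n) ℓ' → (Fin m → LinPoly n) →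
           Subset m → Set (ℓ ⊔ ℓ')
  Covers M L S =
    (∀ j → j Sub.∈ S → PolyIn M (L j)) ×
    (∀ v → PointOf M v → ∃ λ j → j Sub.∈ S × eval (L j) v ≈ 0#)

  -- the whole cube {0,1}^n
  AllVars : {n : ℕ} → Pred (Fin n) Level.zero
  AllVars _ = Data.Unit.⊤ where import Data.Unit

  IsEssentialisation : {n m : ℕ} {ℓ' : Level} → Pred (Fin n) ℓ' →
                       (Fin m → LinPoly n) → Subset m → Subset m → Set (ℓ ⊔ ℓ')
  IsEssentialisation M L S S' =
    S' Sub.⊆ S × Covers M L S' × (∀ T → T Sub.⊂ S' → ¬ Covers M L T)

  VarsOf : {n m : ℕ} → (Fin m → LinPoly n) → Subset m → Pred (Fin n) ℓ
  VarsOf L S i = ∃ λ j → j Sub.∈ S × ¬ (coeff (L j) i ≈ 0#)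

  IsEssentialCover : {n m : ℕ} {ℓ' : Level} → Pred (Fin n) ℓ' →
                     (Fin m → LinPoly n) → Subset m → Set (ℓ ⊔ ℓ')
  IsEssentialCover M L S =
    Covers M L S ×
    (∀ T → T Sub.⊂ S → ¬ Covers M L T) ×
    (∀ i → M i → ∃ λ j → j Sub.∈ S × ¬ (coeff (L j) i ≈ 0#))

{-# OPTIONS --safe #-}
module Submission where

-- Fix, for every point of the cube, a member of the essentialisation S vanishing there.
-- Let i be a variable occurring in no member of S, and j ∈ S.  If two points differing
-- only in coordinate i are both assigned L j, then L j vanishes at both, so its
-- coefficient of x_i is 0.  Otherwise every point assigned L j can be moved along
-- coordinate i to a point assigned another member of S, which vanishes at the original
-- point too; so S - j covers the cube, contradicting minimality.  For (E2), a proper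
-- subfamily covering the subcube on the variables of S covers the whole cube, since its
-- members ignore the other variables.  Neither membership in the set of variables nor
-- vanishing of a coefficient is decidable, but each is only used to derive a
-- contradiction, where it may be assumed decidable under double negation.

open import Defs
open import Level using (Level)
open import Algebra.Bundles using (CommutativeRing)
open import Data.Nat using (ℕ)
open import Data.Fin using (Fin; zero; suc; _≟_)
open import Data.Fin.Subset using (Subset; ⊤; _∈_; _⊂_; _-_)

open import Data.Bool using (Bool; true; false; not; if_then_else_)
open import Data.Bool.Properties using (not-¬)
open import Data.Empty using (⊥-elim)
open import Data.Fin.Properties using (∀-cons; suc-injective)
open import Data.Fin.Subset.Properties using (anySubset?; x∈p∧x≢y⇒x∈p-y; x∈p⇒p-x⊂p)
open import Data.Product using (∃; _×_; _,_; proj₁; proj₂)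
open import Data.Sum using (_⊎_; inj₁; inj₂)
open import Data.Unit using (tt)
open import Data.Vec using (lookup; tabulate; _[_]%=_)
open import Data.Vec.Properties using (lookup∘tabulate; lookup∘updateAt; lookup∘updateAt′)
open import Function using (_∘_)
open import Relation.Nullary using (¬_; yes; no; does; contradiction)
open import Relation.Nullary.Decidable using (_×-dec_; ¬¬-excluded-middle)
open import Relation.Unary using (Pred; Decidable)
open import Relation.Binary.PropositionalEquality as ≡ using (_≡_; _≢_)

¬¬-∀-Fin : ∀ {a n} {Q : Fin n → Set a} → (∀ k → ¬ ¬ Q k) → ¬ ¬ (∀ k → Q k)
¬¬-∀-Fin {n = ℕ.zero}  _   ¬∀ = ¬∀ (λ ())
¬¬-∀-Fin {n = ℕ.suc n} ¬¬Q ¬∀ = ¬¬Q zero λ q₀ → ¬¬-∀-Fin (¬¬Q ∘ suc) (¬∀ ∘ ∀-cons q₀)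

¬¬-decidable : ∀ {p n} {P : Pred (Fin n) p} → ¬ ¬ Decidable P
¬¬-decidable = ¬¬-∀-Fin (λ _ → ¬¬-excluded-middle)

module EssentialCovers {c ℓ : Level} (R : CommutativeRing c ℓ) where
  open CommutativeRing R hiding (zero; _-_)
  open Lin R
  open import Algebra.Properties.CommutativeSemigroup +-commutativeSemigroup using (xy∙z≈xz∙y)
  open import Relation.Binary.Reasoning.Setoid setoid

  sumFin-cong : ∀ {n} {f g : Fin n → Carrier} → (∀ k → f k ≈ g k) → sumFin f ≈ sumFin g
  sumFin-cong {ℕ.zero}  f≈g = refl
  sumFin-cong {ℕ.suc n} f≈g = +-cong (f≈g zero) (sumFin-cong (f≈g ∘ suc))

  sumFin-perturbed : ∀ {n} (i : Fin n) {f g : Fin n → Carrier} {d : Carrier} →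
    (∀ k → k ≢ i → g k ≈ f k) → g i ≈ f i + d → sumFin g ≈ sumFin f + d
  sumFin-perturbed zero {f} {g} {d} g≈f gi≈fi+d = begin
    g zero + sumFin (g ∘ suc)     ≈⟨ +-cong gi≈fi+d (sumFin-cong (λ k → g≈f (suc k) λ ())) ⟩
    f zero + d + sumFin (f ∘ suc) ≈⟨ xy∙z≈xz∙y _ _ _ ⟩
    f zero + sumFin (f ∘ suc) + d ∎
  sumFin-perturbed (suc i) {f} {g} {d} g≈f gi≈fi+d = begin
    g zero + sumFin (g ∘ suc)       ≈⟨ +-cong (g≈f zero λ ()) (sumFin-perturbed i g∘suc≈f∘suc gi≈fi+d) ⟩
    f zero + (sumFin (f ∘ suc) + d) ≈⟨ sym (+-assoc _ _ _) ⟩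
    f zero + sumFin (f ∘ suc) + d   ∎
    where
    g∘suc≈f∘suc : ∀ k → k ≢ i → g (suc k) ≈ f (suc k)
    g∘suc≈f∘suc k k≢i = g≈f (suc k) (k≢i ∘ suc-injective)

  x+d≈0∧x≈0⇒d≈0 : ∀ {x d} → x + d ≈ 0# → x ≈ 0# → d ≈ 0#
  x+d≈0∧x≈0⇒d≈0 {x} {d} x+d≈0 x≈0 = begin
    d      ≈⟨ +-identityˡ d ⟨
    0# + d ≈⟨ +-cong x≈0 refl ⟨
    x + d  ≈⟨ x+d≈0 ⟩
    0#     ∎

  eval-cong-on-support : ∀ {n} (p : LinPoly n) {v w : Fin n → Bool} →
    (∀ k → coeff p k ≈ 0# ⊎ v k ≡ w k) → eval p v ≈ eval p w
  eval-cong-on-support p {v} {w} agree = +-cong refl (sumFin-cong term)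
    where
    term : ∀ k → coeff p k * bit (v k) ≈ coeff p k * bit (w k)
    term k with agree k
    ... | inj₂ vk≡wk = reflexive (≡.cong (λ b → coeff p k * bit b) vk≡wk)
    ... | inj₁ ck≈0 = begin
      coeff p k * bit (v k) ≈⟨ *-cong ck≈0 refl ⟩
      0# * bit (v k)        ≈⟨ zeroˡ _ ⟩
      0#                    ≈⟨ zeroˡ _ ⟨
      0# * bit (w k)        ≈⟨ *-cong ck≈0 refl ⟨
      coeff p k * bit (w k) ∎

  eval-raise : ∀ {n} (p : LinPoly n) (i : Fin n) {v w : Fin n → Bool} →
    v i ≡ false → w i ≡ true → (∀ k → k ≢ i → v k ≡ w k) →
    eval p w ≈ eval p v + coeff p i
  eval-raise p i {v} {w} vi≡false wi≡true agree = begin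
    const p + sumFin (term w)               ≈⟨ +-cong refl (sumFin-perturbed i off-i at-i) ⟩
    const p + (sumFin (term v) + coeff p i) ≈⟨ +-assoc _ _ _ ⟨
    const p + sumFin (term v) + coeff p i   ∎
    where
    term : (Fin _ → Bool) → Fin _ → Carrier
    term u k = coeff p k * bit (u k)
    off-i : ∀ k → k ≢ i → term w k ≈ term v k
    off-i k k≢i = reflexive (≡.cong (λ b → coeff p k * bit b) (≡.sym (agree k k≢i)))
    at-i : term w i ≈ term v i + coeff p i
    at-i rewrite vi≡false | wi≡true = begin
      coeff p i * 1#             ≈⟨ *-identityʳ _ ⟩
      coeff p i                  ≈⟨ +-identityˡ _ ⟨
      0# + coeff p i             ≈⟨ +-cong (zeroʳ _) refl ⟨
      coeff p i * 0# + coeff p i ∎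

  coeff≈0-between-adjacent-zeros : ∀ {n} (p : LinPoly n) (i : Fin n) {v w : Fin n → Bool} →
    v i ≢ w i → (∀ k → k ≢ i → v k ≡ w k) →
    eval p v ≈ 0# → eval p w ≈ 0# → coeff p i ≈ 0#
  coeff≈0-between-adjacent-zeros p i {v} {w} vi≢wi agree pv≈0 pw≈0
    with v i in vi | w i in wi
  ... | false | true  =
    x+d≈0∧x≈0⇒d≈0 (trans (sym (eval-raise p i vi wi agree)) pw≈0) pv≈0
  ... | true  | false =
    x+d≈0∧x≈0⇒d≈0 (trans (sym (eval-raise p i wi vi (λ k → ≡.sym ∘ agree k))) pv≈0) pw≈0
  ... | false | false = contradiction ≡.refl vi≢wi
  ... | true  | true  = contradiction ≡.refl vi≢wi

  restrict : ∀ {p n} {M : Pred (Fin n) p} → Decidable M → (Fin n → Bool) → Fin n → Bool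
  restrict M? v k = if does (M? k) then v k else false

  restrict-pointOf : ∀ {p n} {M : Pred (Fin n) p} (M? : Decidable M) (v : Fin n → Bool) →
    PointOf M (restrict M? v)
  restrict-pointOf M? v k k∉M with M? k
  ... | yes k∈M = contradiction k∈M k∉M
  ... | no _    = ≡.refl

  module _ {n m : ℕ} (L : Fin m → LinPoly n) where

    CoversCube : Subset m → Set ℓ
    CoversCube S = ∀ v → ∃ λ j → j ∈ S × eval (L j) v ≈ 0#

    covers-AllVars⁺ : ∀ {S} → CoversCube S → Covers AllVars L S
    covers-AllVars⁺ cover = (λ _ _ _ ¬⊤ → contradiction tt ¬⊤) , λ v _ → cover v

    covers-AllVars⁻ : ∀ {S} → Covers AllVars L S → CoversCube S
    covers-AllVars⁻ (_ , cover) v = cover v (λ _ ¬⊤ → contradiction tt ¬⊤)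

    coversCube-of-subcube : ∀ {p} {M : Pred (Fin n) p} {T} → Decidable M →
      Covers M L T → CoversCube T
    coversCube-of-subcube M? (inM , cover) v with cover (restrict M? v) (restrict-pointOf M? v)
    ... | j , j∈T , Lj≈0 = j , j∈T , trans (eval-cong-on-support (L j) agree) Lj≈0
      where
      agree : ∀ k → coeff (L j) k ≈ 0# ⊎ v k ≡ restrict M? v k
      agree k with M? k
      ... | yes _  = inj₂ ≡.refl
      ... | no k∉M = inj₁ (inM j j∈T k k∉M)

    ¬VarsOf⇒¬¬vanishing : ∀ {S i} → ¬ VarsOf L S i → ¬ ¬ (∀ k → k ∈ S → coeff (L k) i ≈ 0#)
    ¬VarsOf⇒¬¬vanishing i∉vars = ¬¬-∀-Fin λ k ¬vanishing →
      ¬vanishing λ k∈S → contradiction (k , k∈S , λ c≈0 → ¬vanishing (λ _ → c≈0)) i∉vars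

    -- Points of the cube are enumerated as `Subset n` (that is, `Vec Bool n`), so that
    -- `anySubset?` can search them.
    module _ {S : Subset m} (cover : CoversCube S) where

      chosen : Subset n → Fin m
      chosen u = proj₁ (cover (lookup u))

      chosen∈S : ∀ u → chosen u ∈ S
      chosen∈S u = proj₁ (proj₂ (cover (lookup u)))

      chosen-vanishes : ∀ u → eval (L (chosen u)) (lookup u) ≈ 0#
      chosen-vanishes u = proj₂ (proj₂ (cover (lookup u)))

      member-vanishing-at : ∀ {j} v u → chosen u ≢ j →
        (∀ k → coeff (L (chosen u)) k ≈ 0# ⊎ v k ≡ lookup u k) →
        ∃ λ k → k ∈ S - j × eval (L k) v ≈ 0#
      member-vanishing-at v u ≢j agree =
        chosen u , x∈p∧x≢y⇒x∈p-y (chosen∈S u) ≢j ,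
        trans (eval-cong-on-support (L (chosen u)) agree) (chosen-vanishes u)

      coversCube-without : ∀ i j → (∀ k → k ∈ S → coeff (L k) i ≈ 0#) →
        (∀ u → chosen u ≡ j → chosen (u [ i ]%= not) ≢ j) → CoversCube (S - j)
      coversCube-without i j vanishing never v with chosen (tabulate v) ≟ j
      ... | no ≢j  =
        member-vanishing-at v (tabulate v) ≢j λ k → inj₂ (≡.sym (lookup∘tabulate v k))
      ... | yes ≡j = member-vanishing-at v u′ (never (tabulate v) ≡j) agree
        where
        u′ : Subset n
        u′ = tabulate v [ i ]%= not
        agree : ∀ k → coeff (L (chosen u′)) k ≈ 0# ⊎ v k ≡ lookup u′ k
        agree k with k ≟ i
        ... | yes ≡.refl = inj₁ (vanishing (chosen u′) (chosen∈S u′))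
        ... | no k≢i     =
          inj₂ (≡.sym (≡.trans (lookup∘updateAt′ k i k≢i (tabulate v)) (lookup∘tabulate v k)))

      coeff≈0-outside-VarsOf : (∀ T → T ⊂ S → ¬ CoversCube T) →
        ∀ j → j ∈ S → ∀ i → ¬ VarsOf L S i → coeff (L j) i ≈ 0#
      coeff≈0-outside-VarsOf minimal j j∈S i i∉vars
        with anySubset? (λ u → (chosen u ≟ j) ×-dec (chosen (u [ i ]%= not) ≟ j))
      ... | yes (u , ≡.refl , flipped≡j) =
        coeff≈0-between-adjacent-zeros (L j) i differ agree (chosen-vanishes u)
          (≡.subst (λ k → eval (L k) (lookup u′) ≈ 0#) flipped≡j (chosen-vanishes u′))
        where
        u′ : Subset n
        u′ = u [ i ]%= not
        differ : lookup u i ≢ lookup u′ i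
        differ ui≡u′i = not-¬ ≡.refl (≡.trans ui≡u′i (lookup∘updateAt i u))
        agree : ∀ k → k ≢ i → lookup u k ≡ lookup u′ k
        agree k k≢i = ≡.sym (lookup∘updateAt′ k i k≢i u)
      ... | no none = ⊥-elim (¬VarsOf⇒¬¬vanishing i∉vars λ vanishing →
        minimal (S - j) (x∈p⇒p-x⊂p j∈S)
          (coversCube-without i j vanishing λ u ≡j flipped≡j → none (u , ≡j , flipped≡j)))

mainTheorem20 : {c ℓ : Level} (R : CommutativeRing c ℓ) →
    let open Lin R in
    (n m : ℕ) (L : Fin m → LinPoly n) →
    Covers AllVars L ⊤ →
    (L' : Subset m) → IsEssentialisation AllVars L ⊤ L' →
    IsEssentialCover (VarsOf L L') L L'
mainTheorem20 R n m L _ L' (_ , L'-covers , L'-essential) =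
  (inVars , λ v _ → cover v) , no-proper-subcover , λ _ i∈vars → i∈vars
  where
  open Lin R
  open EssentialCovers R
  cover : CoversCube L L'
  cover = covers-AllVars⁻ L L'-covers
  minimal : ∀ T → T ⊂ L' → ¬ CoversCube L T
  minimal T T⊂L' = L'-essential T T⊂L' ∘ covers-AllVars⁺ L
  inVars : ∀ j → j ∈ L' → PolyIn (VarsOf L L') (L j)
  inVars j j∈L' = coeff≈0-outside-VarsOf L cover minimal j j∈L'
  no-proper-subcover : ∀ T → T ⊂ L' → ¬ Covers (VarsOf L L') L T
  no-proper-subcover T T⊂L' T-covers =
    ¬¬-decidable λ vars? → minimal T T⊂L' (coversCube-of-subcube L vars? T-covers)
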